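{- Let $G(t)\in\mathbb{Z}[t]$ with $\deg(G)=N$, and suppose that $G(t)$ factors into a product of distinct non-constant polynomials that are irreducible over $\mathbb{Z}$, each of degree at most $3$. If $G(t)$ has a local obstruction at the prime $\ell$, then $\ell\le (N_\ell+2)/2$, where $N_\ell$ is the number of not-necessarily distinct non-constant linear factors of $G(t)$ in $\mathbb{F}_\ell[t]$.
   Context: For $G(t)\in\mathbb{Z}[t]$ and a prime $\ell$, $G$ is said to have a local obstruction at $\ell$ if $G(z)\equiv 0\pmod{\ell^2}$ for every $z\in(\mathbb{Z}/\ell^2\mathbb{Z})^{*}$. -}

module Defs where

open import Data.Nat as ℕ using (ℕ; zero; suc; _<_)
open import Data.Integer as ℤ using (ℤ; +_; 0ℤ; 1ℤ; -1ℤ)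
open import Data.Integer.Divisibility as ℤD using ()
open import Data.Nat.Divisibility using () renaming (_∣_ to _∣ℕ_)
open import Data.List using (List; []; _∷_; map; foldr)
open import Data.Product using (Σ; _×_; ∃)
open import Data.Sum using (_⊎_)
open import Relation.Nullary using (¬_)
open import Relation.Binary.PropositionalEquality using (_≡_; _≢_)

-- Polynomials in ℤ[t] as coefficient lists, lowest degree first.
-- Trailing zeros are allowed; equality of polynomials is coefficientwise (_≈ₚ_).
Poly : Set
Poly = List ℤ

coeff : Poly → ℕ → ℤ
coeff []       _       = 0ℤ
coeff (c ∷ p)  zero    = c
coeff (c ∷ p)  (suc n) = coeff p n

_+ₚ_ : Poly → Poly → Poly
[]      +ₚ q       = q
(c ∷ p) +ₚ []      = c ∷ p
(c ∷ p) +ₚ (d ∷ q) = (c ℤ.+ d) ∷ (p +ₚ q)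

negₚ : Poly → Poly
negₚ = map (λ c → ℤ.- c)

_*ₚ_ : Poly → Poly → Poly
[]      *ₚ q = []
(c ∷ p) *ₚ q = map (c ℤ.*_) q +ₚ (0ℤ ∷ (p *ₚ q))

oneₚ : Poly
oneₚ = 1ℤ ∷ []

prodₚ : List Poly → Poly
prodₚ = foldr _*ₚ_ oneₚ

powₚ : Poly → ℕ → Poly
powₚ p zero    = oneₚ
powₚ p (suc k) = p *ₚ powₚ p k

eval : Poly → ℤ → ℤ
eval []      z = 0ℤ
eval (c ∷ p) z = c ℤ.+ z ℤ.* eval p z

_≈ₚ_ : Poly → Poly → Set
p ≈ₚ q = ∀ n → coeff p n ≡ coeff q n

HasDegree : Poly → ℕ → Set
HasDegree p N = coeff p N ≢ 0ℤ × (∀ n → N < n → coeff p n ≡ 0ℤ)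

DegreeAtMost : ℕ → Poly → Set
DegreeAtMost d p = ∀ n → d < n → coeff p n ≡ 0ℤ

NonConstant : Poly → Set
NonConstant p = Σ ℕ λ n → 0 < n × coeff p n ≢ 0ℤ

IsUnitℤ[t] : Poly → Set
IsUnitℤ[t] p = p ≈ₚ (1ℤ ∷ []) ⊎ p ≈ₚ (-1ℤ ∷ [])

IrreducibleZ : Poly → Set
IrreducibleZ f = ¬ (f ≈ₚ []) × ¬ IsUnitℤ[t] f
               × (∀ g h → f ≈ₚ (g *ₚ h) → IsUnitℤ[t] g ⊎ IsUnitℤ[t] h)

Associated : Poly → Poly → Set
Associated f g = f ≈ₚ g ⊎ f ≈ₚ negₚ g

NonAssociated : Poly → Poly → Set
NonAssociated f g = ¬ Associated f g

-- local obstruction at ℓ: G(z) ≡ 0 mod ℓ² for every z ∈ (ℤ/ℓ²ℤ)^*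
-- (units mod ℓ² for prime ℓ are the residues 0 ≤ z < ℓ² with ℓ ∤ z)
LocalObstruction : Poly → ℕ → Set
LocalObstruction G ℓ =
  ∀ (z : ℕ) → z < ℓ ℕ.* ℓ → ¬ (ℓ ∣ℕ z) → (+ (ℓ ℕ.* ℓ)) ℤD.∣ eval G (+ z)

-- divisibility d ∣ G in 𝔽_ℓ[t] (d and G taken modulo ℓ):
-- ∃ Q ∈ ℤ[t] with every coefficient of G - d·Q divisible by ℓ
DividesModℓ : ℕ → Poly → Poly → Set
DividesModℓ ℓ d G = Σ Poly λ Q → ∀ n → (+ ℓ) ℤD.∣ (coeff G n ℤ.- coeff (d *ₚ Q) n)

linear : ℕ → Poly
linear a = (ℤ.- (+ a)) ∷ 1ℤ ∷ []

RootMultiplicity : ℕ → Poly → ℕ → ℕ → Set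
RootMultiplicity ℓ G a k =
  DividesModℓ ℓ (powₚ (linear a) k) G × ¬ DividesModℓ ℓ (powₚ (linear a) (suc k)) G

-- For 0 < a < ℓ both a and a + ℓ are units modulo ℓ², so the obstruction gives ℓ² ∣ G(a) and ℓ² ∣ G(a + ℓ).
-- The first makes t − a divide G modulo ℓ, say G ≡ (t − a)Q; comparing G(a) and G(a + ℓ) modulo ℓ² then
-- forces ℓ ∣ Q(a), so (t − a)² divides G modulo ℓ. Each of the ℓ − 1 nonzero residues is therefore a root of
-- multiplicity at least 2 of G modulo ℓ, and N_ℓ ≥ 2(ℓ − 1).
module Submission where

open import Defs
open import Data.Nat as ℕ using (ℕ; zero; suc; _<_; _≤_; _*_; _+_; z≤n; s≤s)
import Data.Nat.Properties as ℕₚ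
open import Data.Nat.Divisibility as ℕ∣ using () renaming (_∣_ to _∣ℕ_)
open import Data.Nat.Primality using (Prime)
open import Data.Integer as ℤ using (ℤ; +_; 0ℤ; 1ℤ)
import Data.Integer.Properties as ℤₚ
open import Data.Integer.Divisibility.Signed
  using (_∣_; divides; ∣ᵤ⇒∣; ∣⇒∣ᵤ; ∣m∣n⇒∣m+n; ∣m∣n⇒∣m-n; ∣n⇒∣m*n; ∣m⇒∣m*n; ∣-refl; ∣-trans; *-cancelˡ-∣)
open import Data.Integer.Tactic.RingSolver using (solve-∀)
open import Data.List using (List; []; _∷_; map; upTo; applyUpTo)
open import Data.Nat.ListAction using (sum)
open import Data.List.Relation.Unary.All using (All)
open import Data.List.Relation.Unary.AllPairs using (AllPairs)
open import Data.Product using (_×_; _,_; ∃-syntax)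
open import Data.Empty using (⊥-elim)
open import Relation.Nullary using (¬_)
open import Relation.Binary.PropositionalEquality
open ≡-Reasoning

coeff-+ₚ : ∀ p q n → coeff (p +ₚ q) n ≡ coeff p n ℤ.+ coeff q n
coeff-+ₚ []      q       n       = sym (ℤₚ.+-identityˡ _)
coeff-+ₚ (c ∷ p) []      n       = sym (ℤₚ.+-identityʳ _)
coeff-+ₚ (c ∷ p) (d ∷ q) zero    = refl
coeff-+ₚ (c ∷ p) (d ∷ q) (suc n) = coeff-+ₚ p q n

coeff-scale : ∀ c p n → coeff (map (c ℤ.*_) p) n ≡ c ℤ.* coeff p n
coeff-scale c []      n       = sym (ℤₚ.*-zeroʳ c)
coeff-scale c (d ∷ p) zero    = refl
coeff-scale c (d ∷ p) (suc n) = coeff-scale c p n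

coeff-negₚ : ∀ p n → coeff (negₚ p) n ≡ ℤ.- coeff p n
coeff-negₚ []      n       = refl
coeff-negₚ (c ∷ p) zero    = refl
coeff-negₚ (c ∷ p) (suc n) = coeff-negₚ p n

eval-+ₚ : ∀ p q z → eval (p +ₚ q) z ≡ eval p z ℤ.+ eval q z
eval-+ₚ []      q       z = sym (ℤₚ.+-identityˡ _)
eval-+ₚ (c ∷ p) []      z = sym (ℤₚ.+-identityʳ _)
eval-+ₚ (c ∷ p) (d ∷ q) z = begin
  (c ℤ.+ d) ℤ.+ z ℤ.* eval (p +ₚ q) z             ≡⟨ cong (λ e → (c ℤ.+ d) ℤ.+ z ℤ.* e) (eval-+ₚ p q z) ⟩
  (c ℤ.+ d) ℤ.+ z ℤ.* (eval p z ℤ.+ eval q z)     ≡⟨ regroup c d z (eval p z) (eval q z) ⟩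
  (c ℤ.+ z ℤ.* eval p z) ℤ.+ (d ℤ.+ z ℤ.* eval q z) ∎
  where
  regroup : ∀ c d z x y → (c ℤ.+ d) ℤ.+ z ℤ.* (x ℤ.+ y) ≡ (c ℤ.+ z ℤ.* x) ℤ.+ (d ℤ.+ z ℤ.* y)
  regroup = solve-∀

eval-scale : ∀ c p z → eval (map (c ℤ.*_) p) z ≡ c ℤ.* eval p z
eval-scale c []      z = sym (ℤₚ.*-zeroʳ c)
eval-scale c (d ∷ p) z = begin
  c ℤ.* d ℤ.+ z ℤ.* eval (map (c ℤ.*_) p) z  ≡⟨ cong (λ e → c ℤ.* d ℤ.+ z ℤ.* e) (eval-scale c p z) ⟩
  c ℤ.* d ℤ.+ z ℤ.* (c ℤ.* eval p z)         ≡⟨ factor c d z (eval p z) ⟩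
  c ℤ.* (d ℤ.+ z ℤ.* eval p z)               ∎
  where
  factor : ∀ c d z x → c ℤ.* d ℤ.+ z ℤ.* (c ℤ.* x) ≡ c ℤ.* (d ℤ.+ z ℤ.* x)
  factor = solve-∀

eval-negₚ : ∀ p z → eval (negₚ p) z ≡ ℤ.- eval p z
eval-negₚ []      z = refl
eval-negₚ (c ∷ p) z = begin
  ℤ.- c ℤ.+ z ℤ.* eval (negₚ p) z  ≡⟨ cong (λ e → ℤ.- c ℤ.+ z ℤ.* e) (eval-negₚ p z) ⟩
  ℤ.- c ℤ.+ z ℤ.* ℤ.- eval p z     ≡⟨ negate c z (eval p z) ⟩
  ℤ.- (c ℤ.+ z ℤ.* eval p z)       ∎
  where
  negate : ∀ c z x → ℤ.- c ℤ.+ z ℤ.* ℤ.- x ≡ ℤ.- (c ℤ.+ z ℤ.* x)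
  negate = solve-∀

eval-*ₚ : ∀ p q z → eval (p *ₚ q) z ≡ eval p z ℤ.* eval q z
eval-*ₚ []      q z = sym (ℤₚ.*-zeroˡ (eval q z))
eval-*ₚ (c ∷ p) q z = begin
  eval (map (c ℤ.*_) q +ₚ (0ℤ ∷ p *ₚ q)) z                ≡⟨ eval-+ₚ (map (c ℤ.*_) q) (0ℤ ∷ p *ₚ q) z ⟩
  eval (map (c ℤ.*_) q) z ℤ.+ (0ℤ ℤ.+ z ℤ.* eval (p *ₚ q) z)
    ≡⟨ cong₂ (λ x y → x ℤ.+ (0ℤ ℤ.+ z ℤ.* y)) (eval-scale c q z) (eval-*ₚ p q z) ⟩
  c ℤ.* eval q z ℤ.+ (0ℤ ℤ.+ z ℤ.* (eval p z ℤ.* eval q z)) ≡⟨ distrib c z (eval p z) (eval q z) ⟩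
  (c ℤ.+ z ℤ.* eval p z) ℤ.* eval q z                     ∎
  where
  distrib : ∀ c z x y → c ℤ.* y ℤ.+ (0ℤ ℤ.+ z ℤ.* (x ℤ.* y)) ≡ (c ℤ.+ z ℤ.* x) ℤ.* y
  distrib = solve-∀

coeff-+ₚ-negₚ : ∀ p q n → coeff (p +ₚ negₚ q) n ≡ coeff p n ℤ.- coeff q n
coeff-+ₚ-negₚ p q n = trans (coeff-+ₚ p (negₚ q) n) (cong (λ x → coeff p n ℤ.+ x) (coeff-negₚ q n))

eval-+ₚ-negₚ : ∀ p q z → eval (p +ₚ negₚ q) z ≡ eval p z ℤ.- eval q z
eval-+ₚ-negₚ p q z = trans (eval-+ₚ p (negₚ q) z) (cong (λ x → eval p z ℤ.+ x) (eval-negₚ q z))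

convolve : Poly → (ℕ → ℤ) → ℕ → ℤ
convolve []      f n       = 0ℤ
convolve (c ∷ p) f zero    = c ℤ.* f zero
convolve (c ∷ p) f (suc n) = c ℤ.* f (suc n) ℤ.+ convolve p f n

coeff-*ₚ : ∀ p q n → coeff (p *ₚ q) n ≡ convolve p (coeff q) n
coeff-*ₚ []      q n       = refl
coeff-*ₚ (c ∷ p) q zero    = begin
  coeff (map (c ℤ.*_) q +ₚ (0ℤ ∷ p *ₚ q)) 0 ≡⟨ coeff-+ₚ (map (c ℤ.*_) q) (0ℤ ∷ p *ₚ q) 0 ⟩
  coeff (map (c ℤ.*_) q) 0 ℤ.+ 0ℤ          ≡⟨ ℤₚ.+-identityʳ _ ⟩
  coeff (map (c ℤ.*_) q) 0                 ≡⟨ coeff-scale c q 0 ⟩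
  c ℤ.* coeff q 0                          ∎
coeff-*ₚ (c ∷ p) q (suc n) = begin
  coeff (map (c ℤ.*_) q +ₚ (0ℤ ∷ p *ₚ q)) (suc n)      ≡⟨ coeff-+ₚ (map (c ℤ.*_) q) (0ℤ ∷ p *ₚ q) (suc n) ⟩
  coeff (map (c ℤ.*_) q) (suc n) ℤ.+ coeff (p *ₚ q) n ≡⟨ cong₂ ℤ._+_ (coeff-scale c q (suc n)) (coeff-*ₚ p q n) ⟩
  c ℤ.* coeff q (suc n) ℤ.+ convolve p (coeff q) n    ∎

convolve-cong : ∀ p {f g : ℕ → ℤ} → (∀ n → f n ≡ g n) → ∀ n → convolve p f n ≡ convolve p g n
convolve-cong []      f≗g n       = refl
convolve-cong (c ∷ p) f≗g zero    = cong (c ℤ.*_) (f≗g zero)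
convolve-cong (c ∷ p) f≗g (suc n) = cong₂ (λ x y → c ℤ.* x ℤ.+ y) (f≗g (suc n)) (convolve-cong p f≗g n)

convolve-+ₚ : ∀ p q f n → convolve (p +ₚ q) f n ≡ convolve p f n ℤ.+ convolve q f n
convolve-+ₚ []      q       f n       = sym (ℤₚ.+-identityˡ _)
convolve-+ₚ (c ∷ p) []      f n       = sym (ℤₚ.+-identityʳ _)
convolve-+ₚ (c ∷ p) (d ∷ q) f zero    = ℤₚ.*-distribʳ-+ (f zero) c d
convolve-+ₚ (c ∷ p) (d ∷ q) f (suc n) = begin
  (c ℤ.+ d) ℤ.* f (suc n) ℤ.+ convolve (p +ₚ q) f n
    ≡⟨ cong (λ x → (c ℤ.+ d) ℤ.* f (suc n) ℤ.+ x) (convolve-+ₚ p q f n) ⟩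
  (c ℤ.+ d) ℤ.* f (suc n) ℤ.+ (convolve p f n ℤ.+ convolve q f n)
    ≡⟨ regroup c d (f (suc n)) (convolve p f n) (convolve q f n) ⟩
  (c ℤ.* f (suc n) ℤ.+ convolve p f n) ℤ.+ (d ℤ.* f (suc n) ℤ.+ convolve q f n) ∎
  where
  regroup : ∀ c d x u v → (c ℤ.+ d) ℤ.* x ℤ.+ (u ℤ.+ v) ≡ (c ℤ.* x ℤ.+ u) ℤ.+ (d ℤ.* x ℤ.+ v)
  regroup = solve-∀

convolve-scale : ∀ c p f n → convolve (map (c ℤ.*_) p) f n ≡ c ℤ.* convolve p f n
convolve-scale c []      f n       = sym (ℤₚ.*-zeroʳ c)
convolve-scale c (d ∷ p) f zero    = ℤₚ.*-assoc c d (f zero)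
convolve-scale c (d ∷ p) f (suc n) = begin
  c ℤ.* d ℤ.* f (suc n) ℤ.+ convolve (map (c ℤ.*_) p) f n
    ≡⟨ cong (λ x → c ℤ.* d ℤ.* f (suc n) ℤ.+ x) (convolve-scale c p f n) ⟩
  c ℤ.* d ℤ.* f (suc n) ℤ.+ c ℤ.* convolve p f n
    ≡⟨ factor c d (f (suc n)) (convolve p f n) ⟩
  c ℤ.* (d ℤ.* f (suc n) ℤ.+ convolve p f n) ∎
  where
  factor : ∀ c d x u → c ℤ.* d ℤ.* x ℤ.+ c ℤ.* u ≡ c ℤ.* (d ℤ.* x ℤ.+ u)
  factor = solve-∀

convolve-*ₚ : ∀ p q f n → convolve (p *ₚ q) f n ≡ convolve p (convolve q f) n
convolve-*ₚ []      q f n       = refl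
convolve-*ₚ (c ∷ p) q f zero    = begin
  convolve (map (c ℤ.*_) q +ₚ (0ℤ ∷ p *ₚ q)) f 0  ≡⟨ convolve-+ₚ (map (c ℤ.*_) q) (0ℤ ∷ p *ₚ q) f 0 ⟩
  convolve (map (c ℤ.*_) q) f 0 ℤ.+ 0ℤ ℤ.* f 0    ≡⟨ cong₂ ℤ._+_ (convolve-scale c q f 0) (ℤₚ.*-zeroˡ (f 0)) ⟩
  c ℤ.* convolve q f 0 ℤ.+ 0ℤ                      ≡⟨ ℤₚ.+-identityʳ _ ⟩
  c ℤ.* convolve q f 0                             ∎
convolve-*ₚ (c ∷ p) q f (suc n) = begin
  convolve (map (c ℤ.*_) q +ₚ (0ℤ ∷ p *ₚ q)) f (suc n)
    ≡⟨ convolve-+ₚ (map (c ℤ.*_) q) (0ℤ ∷ p *ₚ q) f (suc n) ⟩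
  convolve (map (c ℤ.*_) q) f (suc n) ℤ.+ (0ℤ ℤ.* f (suc n) ℤ.+ convolve (p *ₚ q) f n)
    ≡⟨ cong₂ (λ x y → x ℤ.+ (0ℤ ℤ.* f (suc n) ℤ.+ y)) (convolve-scale c q f (suc n)) (convolve-*ₚ p q f n) ⟩
  c ℤ.* convolve q f (suc n) ℤ.+ (0ℤ ℤ.* f (suc n) ℤ.+ convolve p (convolve q f) n)
    ≡⟨ cong (λ x → c ℤ.* convolve q f (suc n) ℤ.+ x) (ℤₚ.+-identityˡ _) ⟩
  c ℤ.* convolve q f (suc n) ℤ.+ convolve p (convolve q f) n ∎

convolve-constant : ∀ c f n → convolve (c ∷ []) f n ≡ c ℤ.* f n
convolve-constant c f zero    = refl
convolve-constant c f (suc n) = ℤₚ.+-identityʳ _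

*ₚ-assoc : ∀ p q r → ((p *ₚ q) *ₚ r) ≈ₚ (p *ₚ (q *ₚ r))
*ₚ-assoc p q r n = begin
  coeff ((p *ₚ q) *ₚ r) n             ≡⟨ coeff-*ₚ (p *ₚ q) r n ⟩
  convolve (p *ₚ q) (coeff r) n        ≡⟨ convolve-*ₚ p q (coeff r) n ⟩
  convolve p (convolve q (coeff r)) n  ≡⟨ convolve-cong p (λ k → sym (coeff-*ₚ q r k)) n ⟩
  convolve p (coeff (q *ₚ r)) n        ≡⟨ coeff-*ₚ p (q *ₚ r) n ⟨
  coeff (p *ₚ (q *ₚ r)) n              ∎

*ₚ-identityˡ : ∀ p → (oneₚ *ₚ p) ≈ₚ p
*ₚ-identityˡ p n = trans (coeff-*ₚ oneₚ p n) (trans (convolve-constant 1ℤ (coeff p) n) (ℤₚ.*-identityˡ _))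

i∣0 : ∀ l → l ∣ 0ℤ
i∣0 l = divides 0ℤ (sym (ℤₚ.*-zeroˡ l))

infix 4 _≡ₚ_[mod_] _∣ₚ_[mod_]

record _≡ₚ_[mod_] (p q : Poly) (l : ℤ) : Set where
  constructor coeffwise
  field
    coeff-∣ : ∀ n → l ∣ coeff p n ℤ.- coeff q n

open _≡ₚ_[mod_]

_∣ₚ_[mod_] : Poly → Poly → ℤ → Set
d ∣ₚ p [mod l ] = ∃[ q ] p ≡ₚ (d *ₚ q) [mod l ]

≈ₚ⇒≡ₚ : ∀ {l p q} → p ≈ₚ q → p ≡ₚ q [mod l ]
≈ₚ⇒≡ₚ {l} {p} p≈q = coeffwise λ n →
  subst (λ x → l ∣ coeff p n ℤ.- x) (p≈q n) (subst (l ∣_) (sym (ℤₚ.+-inverseʳ (coeff p n))) (i∣0 l))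

≡ₚ-trans : ∀ {l p q r} → p ≡ₚ q [mod l ] → q ≡ₚ r [mod l ] → p ≡ₚ r [mod l ]
≡ₚ-trans {l} {p} {q} {r} p≡q q≡r = coeffwise λ n →
  subst (l ∣_) (telescope (coeff p n) (coeff q n) (coeff r n)) (∣m∣n⇒∣m+n (p≡q .coeff-∣ n) (q≡r .coeff-∣ n))
  where
  telescope : ∀ x y z → (x ℤ.- y) ℤ.+ (y ℤ.- z) ≡ x ℤ.- z
  telescope = solve-∀

convolve-mod : ∀ {l} p {f g : ℕ → ℤ} → (∀ n → l ∣ f n ℤ.- g n) →
               ∀ n → l ∣ convolve p f n ℤ.- convolve p g n
convolve-mod {l} []      f≡g n       = i∣0 l
convolve-mod {l} (c ∷ p) {f} {g} f≡g zero =
  subst (l ∣_) (distrib c (f zero) (g zero)) (∣n⇒∣m*n c (f≡g zero))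
  where
  distrib : ∀ c x y → c ℤ.* (x ℤ.- y) ≡ c ℤ.* x ℤ.- c ℤ.* y
  distrib = solve-∀
convolve-mod {l} (c ∷ p) {f} {g} f≡g (suc n) =
  subst (l ∣_) (regroup c (f (suc n)) (g (suc n)) (convolve p f n) (convolve p g n))
    (∣m∣n⇒∣m+n (∣n⇒∣m*n c (f≡g (suc n))) (convolve-mod p f≡g n))
  where
  regroup : ∀ c x y u v → c ℤ.* (x ℤ.- y) ℤ.+ (u ℤ.- v) ≡ (c ℤ.* x ℤ.+ u) ℤ.- (c ℤ.* y ℤ.+ v)
  regroup = solve-∀

*ₚ-congˡ-mod : ∀ {l} p {q r} → q ≡ₚ r [mod l ] → (p *ₚ q) ≡ₚ (p *ₚ r) [mod l ]
*ₚ-congˡ-mod {l} p {q} {r} q≡r = coeffwise λ n →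
  subst₂ (λ x y → l ∣ x ℤ.- y) (sym (coeff-*ₚ p q n)) (sym (coeff-*ₚ p r n)) (convolve-mod p (q≡r .coeff-∣) n)

common-factor : ∀ l p → (∀ n → l ∣ coeff p n) → ∃[ r ] ∀ z → eval p z ≡ l ℤ.* eval r z
common-factor l []      _   = [] , λ _ → sym (ℤₚ.*-zeroʳ l)
common-factor l (c ∷ p) l∣p with common-factor l p (λ n → l∣p (suc n)) | l∣p zero
... | r , p≡lr | divides k c≡kl = k ∷ r , λ z → begin
  c ℤ.+ z ℤ.* eval p z                ≡⟨ cong₂ (λ x y → x ℤ.+ z ℤ.* y) c≡kl (p≡lr z) ⟩
  k ℤ.* l ℤ.+ z ℤ.* (l ℤ.* eval r z)  ≡⟨ factor k l z (eval r z) ⟩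
  l ℤ.* (k ℤ.+ z ℤ.* eval r z)        ∎
  where
  factor : ∀ k l z x → k ℤ.* l ℤ.+ z ℤ.* (l ℤ.* x) ≡ l ℤ.* (k ℤ.+ z ℤ.* x)
  factor = solve-∀

≡ₚ⇒eval-difference : ∀ {l p q} → p ≡ₚ q [mod l ] → ∃[ r ] ∀ z → eval p z ≡ eval q z ℤ.+ l ℤ.* eval r z
≡ₚ⇒eval-difference {l} {p} {q} p≡q
  with common-factor l (p +ₚ negₚ q) (λ n → subst (l ∣_) (sym (coeff-+ₚ-negₚ p q n)) (p≡q .coeff-∣ n))
... | r , p-q≡lr = r , λ z → begin
  eval p z                                ≡⟨ split (eval p z) (eval q z) ⟩
  eval q z ℤ.+ (eval p z ℤ.- eval q z)    ≡⟨ cong (λ x → eval q z ℤ.+ x) (eval-+ₚ-negₚ p q z) ⟨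
  eval q z ℤ.+ eval (p +ₚ negₚ q) z       ≡⟨ cong (λ x → eval q z ℤ.+ x) (p-q≡lr z) ⟩
  eval q z ℤ.+ l ℤ.* eval r z             ∎
  where
  split : ∀ x y → x ≡ y ℤ.+ (x ℤ.- y)
  split = solve-∀

eval-periodic : ∀ l p z → l ∣ eval p (z ℤ.+ l) ℤ.- eval p z
eval-periodic l []      z = i∣0 l
eval-periodic l (c ∷ p) z =
  subst (l ∣_) (regroup c z l (eval p (z ℤ.+ l)) (eval p z))
    (∣m∣n⇒∣m+n (∣n⇒∣m*n z (eval-periodic l p z)) (∣m⇒∣m*n (eval p (z ℤ.+ l)) ∣-refl))
  where
  regroup : ∀ c z l x y → z ℤ.* (x ℤ.- y) ℤ.+ l ℤ.* x ≡ (c ℤ.+ (z ℤ.+ l) ℤ.* x) ℤ.- (c ℤ.+ z ℤ.* y)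
  regroup = solve-∀

quotientByLinear : Poly → ℕ → Poly
quotientByLinear []      a = []
quotientByLinear (c ∷ p) a = eval p (+ a) ∷ quotientByLinear p a

module _ (a : ℕ) where
  private
    A : ℤ
    A = + a

  quotient-coeff₀ : ∀ p → coeff p 0 ≡ ℤ.- A ℤ.* coeff (quotientByLinear p a) 0 ℤ.+ eval p A
  quotient-coeff₀ []      = sym (trans (ℤₚ.+-identityʳ _) (ℤₚ.*-zeroʳ (ℤ.- A)))
  quotient-coeff₀ (c ∷ p) = split c A (eval p A)
    where
    split : ∀ c a x → c ≡ ℤ.- a ℤ.* x ℤ.+ (c ℤ.+ a ℤ.* x)
    split = solve-∀

  quotient-coeffₛ : ∀ p n → coeff p (suc n) ≡ ℤ.- A ℤ.* coeff (quotientByLinear p a) (suc n) ℤ.+ coeff (quotientByLinear p a) n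
  quotient-coeffₛ []      n       = sym (trans (ℤₚ.+-identityʳ _) (ℤₚ.*-zeroʳ (ℤ.- A)))
  quotient-coeffₛ (c ∷ p) zero    = quotient-coeff₀ p
  quotient-coeffₛ (c ∷ p) (suc n) = quotient-coeffₛ p n

  coeff-linear-*ₚ : ∀ q n → coeff (linear a *ₚ q) (suc n) ≡ ℤ.- A ℤ.* coeff q (suc n) ℤ.+ coeff q n
  coeff-linear-*ₚ q n = trans (coeff-*ₚ (linear a) q (suc n))
    (cong (λ x → ℤ.- A ℤ.* coeff q (suc n) ℤ.+ x) (trans (convolve-constant 1ℤ (coeff q) n) (ℤₚ.*-identityˡ _)))

  remainder-theorem : ∀ p → p ≈ₚ ((linear a *ₚ quotientByLinear p a) +ₚ (eval p A ∷ []))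
  remainder-theorem p zero    = begin
    coeff p 0                                             ≡⟨ quotient-coeff₀ p ⟩
    ℤ.- A ℤ.* coeff (quotientByLinear p a) 0 ℤ.+ eval p A ≡⟨ cong (ℤ._+ eval p A) (coeff-*ₚ (linear a) (quotientByLinear p a) 0) ⟨
    coeff (linear a *ₚ quotientByLinear p a) 0 ℤ.+ eval p A ≡⟨ coeff-+ₚ (linear a *ₚ quotientByLinear p a) (eval p A ∷ []) 0 ⟨
    coeff ((linear a *ₚ quotientByLinear p a) +ₚ (eval p A ∷ [])) 0 ∎
  remainder-theorem p (suc n) = begin
    coeff p (suc n)                                       ≡⟨ quotient-coeffₛ p n ⟩
    ℤ.- A ℤ.* coeff (quotientByLinear p a) (suc n) ℤ.+ coeff (quotientByLinear p a) n
      ≡⟨ coeff-linear-*ₚ (quotientByLinear p a) n ⟨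
    coeff (linear a *ₚ quotientByLinear p a) (suc n)      ≡⟨ ℤₚ.+-identityʳ _ ⟨
    coeff (linear a *ₚ quotientByLinear p a) (suc n) ℤ.+ 0ℤ
      ≡⟨ coeff-+ₚ (linear a *ₚ quotientByLinear p a) (eval p A ∷ []) (suc n) ⟨
    coeff ((linear a *ₚ quotientByLinear p a) +ₚ (eval p A ∷ [])) (suc n) ∎

+ₚ-absorb-mod : ∀ {l} p r → (∀ n → l ∣ coeff r n) → (p +ₚ r) ≡ₚ p [mod l ]
+ₚ-absorb-mod {l} p r l∣r = coeffwise λ n → subst (l ∣_) (sym (difference n)) (l∣r n)
  where
  cancel : ∀ x y → x ℤ.+ y ℤ.- x ≡ y
  cancel = solve-∀
  difference : ∀ n → coeff (p +ₚ r) n ℤ.- coeff p n ≡ coeff r n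
  difference n = trans (cong (ℤ._- coeff p n) (coeff-+ₚ p r n)) (cancel (coeff p n) (coeff r n))

factor-theorem-mod : ∀ {l} a p → l ∣ eval p (+ a) → linear a ∣ₚ p [mod l ]
factor-theorem-mod {l} a p l∣p[a] =
  quotientByLinear p a ,
  ≡ₚ-trans (≈ₚ⇒≡ₚ (remainder-theorem a p)) (+ₚ-absorb-mod (linear a *ₚ quotientByLinear p a) _ l∣remainder)
  where
  l∣remainder : ∀ n → l ∣ coeff (eval p (+ a) ∷ []) n
  l∣remainder zero    = l∣p[a]
  l∣remainder (suc n) = i∣0 l

∣ₚ-via-quotient : ∀ {l p q} d e → p ≡ₚ (d *ₚ q) [mod l ] → e ∣ₚ q [mod l ] → (d *ₚ e) ∣ₚ p [mod l ]
∣ₚ-via-quotient d e p≡dq (r , q≡er) =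
  r , ≡ₚ-trans p≡dq (≡ₚ-trans (*ₚ-congˡ-mod d q≡er) (≈ₚ⇒≡ₚ (λ n → sym (*ₚ-assoc d e r n))))

∣ₚ⇒powₚ-1-∣ₚ : ∀ {l p} d → d ∣ₚ p [mod l ] → powₚ d 1 ∣ₚ p [mod l ]
∣ₚ⇒powₚ-1-∣ₚ d (q , p≡dq) = ∣ₚ-via-quotient d oneₚ p≡dq (q , ≈ₚ⇒≡ₚ (λ n → sym (*ₚ-identityˡ q n)))

≡ₚ-powₚ-1 : ∀ {l p} d q → p ≡ₚ (powₚ d 1 *ₚ q) [mod l ] → p ≡ₚ (d *ₚ q) [mod l ]
≡ₚ-powₚ-1 d q p≡d1q =
  ≡ₚ-trans p≡d1q (≡ₚ-trans (≈ₚ⇒≡ₚ (*ₚ-assoc d oneₚ q)) (*ₚ-congˡ-mod d (≈ₚ⇒≡ₚ (*ₚ-identityˡ q))))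

toDividesModℓ : ∀ {ℓ p} d → d ∣ₚ p [mod + ℓ ] → DividesModℓ ℓ d p
toDividesModℓ d (q , p≡dq) = q , λ n → ∣⇒∣ᵤ (p≡dq .coeff-∣ n)

eval-linear : ∀ a z → eval (linear a) z ≡ z ℤ.- + a
eval-linear a z = simplify (+ a) z
  where
  simplify : ∀ a z → ℤ.- a ℤ.+ z ℤ.* (1ℤ ℤ.+ z ℤ.* 0ℤ) ≡ z ℤ.- a
  simplify = solve-∀

-- Write G(z) = (z − a)Q(z) + l R(z). At a this gives l ∣ R(a); at a + l, where z − a = l, it gives
-- l ∣ Q(a + l) + R(a + l); and Q, R are l-periodic modulo l.
quotient-vanishes-mod : ∀ {l} .{{_ : ℤ.NonZero l}} {G Q} a →
                        (l ℤ.* l) ∣ eval G (+ a) → (l ℤ.* l) ∣ eval G (+ a ℤ.+ l) →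
                        G ≡ₚ (linear a *ₚ Q) [mod l ] → l ∣ eval Q (+ a)
quotient-vanishes-mod {l} {G} {Q} a l²∣G[a] l²∣G[a+l] G≡LQ with ≡ₚ⇒eval-difference G≡LQ
... | R , G≡LQ+lR =
  subst (l ∣_) (combine (eval Q A) (eval Q B) (eval R A) (eval R B))
    (∣m∣n⇒∣m-n (∣m∣n⇒∣m-n (∣m∣n⇒∣m-n l∣Q[B]+R[B] (eval-periodic l Q A)) (eval-periodic l R A)) l∣R[A])
  where
  A B : ℤ
  A = + a
  B = A ℤ.+ l

  G-at : ∀ z → eval G z ≡ (z ℤ.- A) ℤ.* eval Q z ℤ.+ l ℤ.* eval R z
  G-at z = trans (G≡LQ+lR z)
    (cong (ℤ._+ l ℤ.* eval R z) (trans (eval-*ₚ (linear a) Q z) (cong (ℤ._* eval Q z) (eval-linear a z))))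

  at-A : ∀ a l x y → (a ℤ.- a) ℤ.* x ℤ.+ l ℤ.* y ≡ l ℤ.* y
  at-A = solve-∀
  at-B : ∀ a l x y → ((a ℤ.+ l) ℤ.- a) ℤ.* x ℤ.+ l ℤ.* y ≡ l ℤ.* (x ℤ.+ y)
  at-B = solve-∀
  combine : ∀ qa qb ra rb → (((qb ℤ.+ rb) ℤ.- (qb ℤ.- qa)) ℤ.- (rb ℤ.- ra)) ℤ.- ra ≡ qa
  combine = solve-∀

  l∣R[A] : l ∣ eval R A
  l∣R[A] = *-cancelˡ-∣ l (subst ((l ℤ.* l) ∣_) (trans (G-at A) (at-A A l (eval Q A) (eval R A))) l²∣G[a])

  l∣Q[B]+R[B] : l ∣ eval Q B ℤ.+ eval R B
  l∣Q[B]+R[B] = *-cancelˡ-∣ l (subst ((l ℤ.* l) ∣_) (trans (G-at B) (at-B A l (eval Q B) (eval R B))) l²∣G[a+l])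

root-multiplicity-≥2 : ∀ {ℓ} .{{_ : ℕ.NonZero ℓ}} G a {k} →
                       (+ ℓ ℤ.* + ℓ) ∣ eval G (+ a) → (+ ℓ ℤ.* + ℓ) ∣ eval G (+ a ℤ.+ + ℓ) →
                       RootMultiplicity ℓ G a k → 2 ≤ k
root-multiplicity-≥2 {ℓ} G a {zero} ℓ²∣G[a] _ (_ , ¬[t-a]∣G) =
  ⊥-elim (¬[t-a]∣G (toDividesModℓ (powₚ (linear a) 1) (∣ₚ⇒powₚ-1-∣ₚ (linear a) [t-a]∣G)))
  where
  [t-a]∣G : linear a ∣ₚ G [mod + ℓ ]
  [t-a]∣G = factor-theorem-mod a G (∣-trans (∣m⇒∣m*n (+ ℓ) ∣-refl) ℓ²∣G[a])
root-multiplicity-≥2 {ℓ} G a {suc zero} ℓ²∣G[a] ℓ²∣G[a+ℓ] ((Q , G≡[t-a]Q) , ¬[t-a]²∣G) =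
  ⊥-elim (¬[t-a]²∣G (toDividesModℓ (powₚ (linear a) 2) [t-a]²∣G))
  where
  G≡[t-a]Q′ : G ≡ₚ (linear a *ₚ Q) [mod + ℓ ]
  G≡[t-a]Q′ = ≡ₚ-powₚ-1 (linear a) Q (coeffwise λ n → ∣ᵤ⇒∣ (G≡[t-a]Q n))
  [t-a]∣Q : powₚ (linear a) 1 ∣ₚ Q [mod + ℓ ]
  [t-a]∣Q = ∣ₚ⇒powₚ-1-∣ₚ (linear a)
              (factor-theorem-mod a Q (quotient-vanishes-mod a ℓ²∣G[a] ℓ²∣G[a+ℓ] G≡[t-a]Q′))
  [t-a]²∣G : powₚ (linear a) 2 ∣ₚ G [mod + ℓ ]
  [t-a]²∣G = ∣ₚ-via-quotient (linear a) (powₚ (linear a) 1) G≡[t-a]Q′ [t-a]∣Q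
root-multiplicity-≥2 G a {suc (suc k)} _ _ _ = s≤s (s≤s z≤n)

obstruction-at-residue : ∀ G {ℓ a} → LocalObstruction G ℓ → 0 < a → a < ℓ →
                         (+ ℓ ℤ.* + ℓ) ∣ eval G (+ a) × (+ ℓ ℤ.* + ℓ) ∣ eval G (+ a ℤ.+ + ℓ)
obstruction-at-residue G {ℓ@(suc (suc j))} {a@(suc _)} obstruction _ a<ℓ@(s≤s (s≤s _)) =
  obstruction-at a<ℓ² ℓ∤a ,
  subst (λ z → (+ ℓ ℤ.* + ℓ) ∣ eval G z) (ℤₚ.pos-+ a ℓ) (obstruction-at a+ℓ<ℓ² ℓ∤a+ℓ)
  where
  obstruction-at : ∀ {z} → z < ℓ * ℓ → ¬ ℓ ∣ℕ z → (+ ℓ ℤ.* + ℓ) ∣ eval G (+ z)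
  obstruction-at {z} z<ℓ² ℓ∤z = subst (_∣ eval G (+ z)) (ℤₚ.pos-* ℓ ℓ) (∣ᵤ⇒∣ (obstruction z z<ℓ² ℓ∤z))

  ℓ∤a : ¬ ℓ ∣ℕ a
  ℓ∤a ℓ∣a = ℕₚ.<⇒≱ a<ℓ (ℕ∣.∣⇒≤ ℓ∣a)

  ℓ∤a+ℓ : ¬ ℓ ∣ℕ (a + ℓ)
  ℓ∤a+ℓ ℓ∣a+ℓ = ℓ∤a (ℕ∣.∣m+n∣m⇒∣n (subst (ℓ ∣ℕ_) (ℕₚ.+-comm a ℓ) ℓ∣a+ℓ) ℕ∣.∣-refl)

  a<ℓ² : a < ℓ * ℓ
  a<ℓ² = ℕₚ.<-≤-trans a<ℓ (ℕₚ.m≤m*n ℓ ℓ)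

  a+ℓ<ℓ² : a + ℓ < ℓ * ℓ
  a+ℓ<ℓ² = ℕₚ.<-≤-trans (ℕₚ.+-monoˡ-< ℓ a<ℓ) (ℕₚ.+-monoʳ-≤ ℓ (ℕₚ.m≤n*m ℓ (suc j)))

sum-applyUpTo-≥ : ∀ k (f g : ℕ → ℕ) n → (∀ i → i < n → k ≤ f (g i)) → k * n ≤ sum (map f (applyUpTo g n))
sum-applyUpTo-≥ k f g zero    _     = ℕₚ.≤-reflexive (ℕₚ.*-zeroʳ k)
sum-applyUpTo-≥ k f g (suc n) k≤f∘g = subst (_≤ sum (map f (applyUpTo g (suc n)))) (sym (ℕₚ.*-suc k n))
  (ℕₚ.+-mono-≤ (k≤f∘g 0 (s≤s z≤n)) (sum-applyUpTo-≥ k f (λ i → g (suc i)) n (λ i i<n → k≤f∘g (suc i) (s≤s i<n))))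

sum-upTo-lower-bound : ∀ ℓ (m : ℕ → ℕ) → (∀ a → 0 < a → a < ℓ → 2 ≤ m a) → 2 * ℓ ≤ sum (map m (upTo ℓ)) + 2
sum-upTo-lower-bound zero    m _        = z≤n
sum-upTo-lower-bound (suc n) m 2≤m[a] = subst₂ _≤_ (sym (ℕₚ.*-suc 2 n)) (ℕₚ.+-comm 2 _)
  (ℕₚ.+-monoʳ-≤ 2 (ℕₚ.≤-trans (sum-applyUpTo-≥ 2 m suc n 2≤m[1+i]) (ℕₚ.m≤n+m _ (m 0))))
  where
  2≤m[1+i] : ∀ i → i < n → 2 ≤ m (suc i)
  2≤m[1+i] i i<n = 2≤m[a] (suc i) (s≤s z≤n) (s≤s i<n)

lemma2p9 : (G : Poly) (N : ℕ) → HasDegree G N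
    → (fs : List Poly) → G ≈ₚ prodₚ fs
    → All (λ f → NonConstant f × IrreducibleZ f × DegreeAtMost 3 f) fs
    → AllPairs NonAssociated fs
    → (ℓ : ℕ) → Prime ℓ → LocalObstruction G ℓ
    → (m : ℕ → ℕ) → (∀ a → a < ℓ → RootMultiplicity ℓ G a (m a))
    → 2 * ℓ ≤ sum (map m (upTo ℓ)) + 2
lemma2p9 G _ _ _ _ _ _ ℓ _ obstruction m multiplicity = sum-upTo-lower-bound ℓ m multiplicity≥2
  where
  multiplicity≥2 : ∀ a → 0 < a → a < ℓ → 2 ≤ m a
  multiplicity≥2 a 0<a a<ℓ with obstruction-at-residue G obstruction 0<a a<ℓ
  ... | ℓ²∣G[a] , ℓ²∣G[a+ℓ] =
    root-multiplicity-≥2 ⦃ ℕ.>-nonZero (ℕₚ.<-trans 0<a a<ℓ) ⦄ G a ℓ²∣G[a] ℓ²∣G[a+ℓ] (multiplicity a a<ℓ)
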